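{- For any instance $I$ of minsum bin packing with ready times, the cost of the output of $NFI^{+}$ applied to all items of $I$ is at most $OPT(I)$.
   Context: Minsum bin packing with ready times: fix an integer $k\ge1$ and integers $1\le\tau_1<\dots<\tau_k$; items $I=G_1\cup\dots\cup G_k$ (disjoint) with weights in $(0,1]$, items of $G_i$ having ready time $\tau_i$. A packing is a sequence of pairwise disjoint bins $B_1,B_2,\dots$ with union $I$, of cost $\sum_j j\,\lvert B_j\rvert$; it is feasible if each bin has total weight at most $1$, and respects ready times if every item of $G_i$ lies in a bin $B_j$ with $j\ge\tau_i$. $OPT(I)$ is the minimum cost of a feasible packing respecting ready times. $NFI^{+}$: sort all items in non-decreasing order of weight and place them in this order into bins $B_1,B_2,\dots$, starting with $B_1$ as current bin and moving to the next bin only after the total weight of the current bin strictly exceeds $1$ (its output may therefore be infeasible).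
   Formalization: The item weights are rational numbers in $(0,1]$. -}

module Defs where

open import Data.Nat as ℕ using (ℕ; zero; suc; _≡ᵇ_)
open import Data.Rational as ℚ using (ℚ; 0ℚ; 1ℚ)
open import Data.Rational.Properties using (_<?_)
open import Data.Fin using (Fin)
open import Data.List using (List; []; _∷_; map; foldr; allFin)
open import Data.Nat.ListAction using (sum)
open import Data.List.Relation.Unary.Linked using (Linked)
open import Data.List.Relation.Binary.Permutation.Propositional using (_↭_)
open import Data.Bool using (if_then_else_)
open import Relation.Nullary using (yes; no)

-- An instance of minsum bin packing with ready times.
-- k groups with ready times τ₁ < … < τₖ (all ≥ 1); n items, item x has
-- weight weight x ∈ (0,1] and belongs to group group x (so G_i = { x | group x = i }).
record Instance : Set where
  field
    k       : ℕ
    k≥1     : 1 ℕ.≤ k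
    τ       : Fin k → ℕ
    τ≥1     : ∀ i → 1 ℕ.≤ τ i
    τ-incr  : ∀ i j → Data.Fin._<_ i j → τ i ℕ.< τ j
    n       : ℕ
    weight  : Fin n → ℚ
    w>0     : ∀ x → 0ℚ ℚ.< weight x
    w≤1     : ∀ x → weight x ℚ.≤ 1ℚ
    group   : Fin n → Fin k

open Instance public

-- A packing B₁, B₂, … (pairwise disjoint, union = I) is given by the
-- (1-based) index of the bin containing each item: x ∈ B_j  iff  bin x ≡ j.
record Packing (I : Instance) : Set where
  field
    bin   : Fin (n I) → ℕ
    bin≥1 : ∀ x → 1 ℕ.≤ bin x

open Packing public

-- Σ_j j·|B_j|  =  Σ_x (index of bin of x)
cost : ∀ {I} → Packing I → ℕ
cost {I} P = sum (map (bin P) (allFin (n I)))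

load : ∀ {I} → Packing I → ℕ → ℚ
load {I} P j = foldr (λ x acc → if bin P x ≡ᵇ j then weight I x ℚ.+ acc else acc) 0ℚ (allFin (n I))

Feasible : ∀ {I} → Packing I → Set
Feasible P = ∀ j → load P j ℚ.≤ 1ℚ

RespectsReadyTimes : ∀ {I} → Packing I → Set
RespectsReadyTimes {I} P = ∀ x → τ I (group I x) ℕ.≤ bin P x

-- NFI⁺ on an (already sorted) sequence of weights: returns the bin index of
-- each item in order.
nfiBins : ℕ → ℚ → List ℚ → List ℕ
nfiBins j s [] = []
nfiBins j s (w ∷ ws) with 1ℚ <? (s ℚ.+ w)
... | yes _ = j ∷ nfiBins (suc j) 0ℚ ws
... | no  _ = j ∷ nfiBins j (s ℚ.+ w) ws

nfiCost : List ℚ → ℕ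
nfiCost ws = sum (nfiBins 1 0ℚ ws)

SortedWeights : Instance → List ℚ → Set
SortedWeights I ws = (ws ↭ map (weight I) (allFin (n I))) Data.Product.× Linked ℚ._≤_ ws
  where import Data.Product

module Submission where

-- For every J, NFI⁺ puts at least as many items into its first J bins as any feasible packing P.
-- Otherwise P puts more items there, say m, and since P's bins hold at most 1 each, the m smallest
-- weights sum to at most J; but NFI⁺ fills bins with the smallest items and leaves a bin only once it
-- is overfull, so the fewer items it placed in bins ≤ J already weigh more than J. As the cost of a
-- packing is Σ_J (number of items outside the first J bins), this dominance gives the cost bound.

open import Defs
open import Data.List using (List)
open import Data.Rational using (ℚ)
open import Data.Nat using (_≤_)

open import Algebra.Bundles using (CommutativeMonoid)
open import Data.Bool using (if_then_else_)
open import Data.List using ([]; _∷_; _++_; length; take; foldr; map; filter; allFin)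
import Data.List.Properties as List
open import Data.List.Relation.Binary.Equality.Propositional using (≋⇒≡)
open import Data.List.Relation.Binary.Permutation.Propositional
  using (_↭_; ↭-refl; ↭-sym; ↭-trans; prep; ↭⇒↭ₛ)
import Data.List.Relation.Binary.Permutation.Propositional.Properties as Perm
open import Data.List.Relation.Unary.All as All using (All; []; _∷_)
import Data.List.Relation.Unary.All.Properties as All
open import Data.List.Relation.Unary.Sorted.TotalOrder.Properties using (↗↭↗⇒≋)
open import Data.Nat as ℕ using (ℕ; zero; suc; _⊓_; _<_; _≤?_; _≡ᵇ_; z≤n; s≤s)
open import Data.Nat.ListAction using (sum)
import Data.Nat.Properties as ℕP
open import Data.Product using (_,_)
open import Data.Rational as ℚ using (0ℚ; 1ℚ; _+_)
import Data.Rational.Properties as ℚP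
open import Relation.Binary.Bundles using (DecTotalOrder)
open import Relation.Binary.Definitions using (tri<; tri≈; tri>)
open import Relation.Binary.PropositionalEquality
open import Relation.Nullary using (Dec; yes; no)
open import Relation.Nullary.Decidable using (dec-true; dec-false)
open import Relation.Unary using (Pred; Decidable)
open import Relation.Unary.Properties using (∁?)

open DecTotalOrder ℚP.≤-decTotalOrder using (totalOrder)
open import Algebra.Properties.CommutativeSemigroup
  (CommutativeMonoid.commutativeSemigroup ℚP.+-0-commutativeMonoid) using (x∙yz≈y∙xz)
open import Data.List.Relation.Unary.Sorted.TotalOrder totalOrder using (Sorted)
open import Data.List.Sort.InsertionSort.Base ℚP.≤-decTotalOrder using (insert; sort)
open import Data.List.Sort.InsertionSort.Properties ℚP.≤-decTotalOrder using (sort-↭; sort-↗)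

toℚ : ℕ → ℚ
toℚ zero    = 0ℚ
toℚ (suc n) = toℚ n + 1ℚ

sumℚ : List ℚ → ℚ
sumℚ = foldr _+_ 0ℚ

sumℚ-nonneg : ∀ {xs} → All (0ℚ ℚ.≤_) xs → 0ℚ ℚ.≤ sumℚ xs
sumℚ-nonneg []           = ℚP.≤-refl
sumℚ-nonneg (x≥0 ∷ xs≥0) = ℚP.+-mono-≤ x≥0 (sumℚ-nonneg xs≥0)

sumℚ-take-mono : ∀ {xs m m′} → All (0ℚ ℚ.≤_) xs → m ≤ m′ →
  sumℚ (take m xs) ℚ.≤ sumℚ (take m′ xs)
sumℚ-take-mono {m′ = m′} xs≥0       z≤n        = sumℚ-nonneg (All.take⁺ m′ xs≥0)
sumℚ-take-mono           []         (s≤s _)    = ℚP.≤-refl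
sumℚ-take-mono {x ∷ _}   (_ ∷ xs≥0) (s≤s m≤m′) = ℚP.+-monoʳ-≤ x (sumℚ-take-mono xs≥0 m≤m′)

sorted-↭-unique : ∀ {xs ys} → Sorted xs → Sorted ys → xs ↭ ys → xs ≡ ys
sorted-↭-unique xs↗ ys↗ xs↭ys = ≋⇒≡ (↗↭↗⇒≋ totalOrder xs↗ ys↗ (↭⇒↭ₛ xs↭ys))

sumℚ-take-insert≤ : ∀ y zs m → sumℚ (take (suc m) (insert y zs)) ℚ.≤ y + sumℚ (take m zs)
sumℚ-take-insert≤ y []       m = ℚP.≤-refl
sumℚ-take-insert≤ y (z ∷ zs) m with y ℚP.≤? z
... | yes y≤z rewrite dec-true (y ℚP.≤? z) y≤z = ℚP.≤-refl
sumℚ-take-insert≤ y (z ∷ zs) zero    | no y≰z rewrite dec-false (y ℚP.≤? z) y≰z =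
  ℚP.+-monoˡ-≤ 0ℚ (ℚP.<⇒≤ (ℚP.≰⇒> y≰z))
sumℚ-take-insert≤ y (z ∷ zs) (suc m) | no y≰z rewrite dec-false (y ℚP.≤? z) y≰z = begin
  z + sumℚ (take (suc m) (insert y zs))  ≤⟨ ℚP.+-monoʳ-≤ z (sumℚ-take-insert≤ y zs m) ⟩
  z + (y + sumℚ (take m zs))             ≡⟨ x∙yz≈y∙xz z y _ ⟩
  y + (z + sumℚ (take m zs))             ∎
  where open ℚP.≤-Reasoning

sumℚ-take-sort≤ : ∀ ys m → sumℚ (take m (sort ys)) ℚ.≤ sumℚ (take m ys)
sumℚ-take-sort≤ ys       zero    = ℚP.≤-refl
sumℚ-take-sort≤ []       (suc m) = ℚP.≤-refl
sumℚ-take-sort≤ (y ∷ ys) (suc m) =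
  ℚP.≤-trans (sumℚ-take-insert≤ y (sort ys) m) (ℚP.+-monoʳ-≤ y (sumℚ-take-sort≤ ys m))

-- Sorted permutations are unique, so xs is sort ys, and each insertion step never increases prefix sums.
sumℚ-take-sorted≤ : ∀ {xs ys} → Sorted xs → xs ↭ ys → ∀ m → sumℚ (take m xs) ℚ.≤ sumℚ (take m ys)
sumℚ-take-sorted≤ {xs} {ys} xs↗ xs↭ys m =
  subst (λ zs → sumℚ (take m zs) ℚ.≤ sumℚ (take m ys))
    (sorted-↭-unique (sort-↗ ys) xs↗ (↭-trans (sort-↭ ys) (↭-sym xs↭ys)))
    (sumℚ-take-sort≤ ys m)

take-length-++ : ∀ {A : Set} (as bs : List A) → take (length as) (as ++ bs) ≡ as
take-length-++ []       bs = refl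
take-length-++ (a ∷ as) bs = cong (a ∷_) (take-length-++ as bs)

sumℚ-take-sorted-++≤ : ∀ {xs} as bs → Sorted xs → xs ↭ as ++ bs → sumℚ (take (length as) xs) ℚ.≤ sumℚ as
sumℚ-take-sorted-++≤ {xs} as bs xs↗ xs↭as++bs =
  subst (λ zs → sumℚ (take (length as) xs) ℚ.≤ sumℚ zs) (take-length-++ as bs)
    (sumℚ-take-sorted≤ xs↗ xs↭as++bs (length as))

module _ {a p} {A : Set a} {P : Pred A p} (P? : Decidable P) where

  filter++filter-∁-↭ : ∀ xs → xs ↭ filter P? xs ++ filter (∁? P?) xs
  filter++filter-∁-↭ []       = ↭-refl
  filter++filter-∁-↭ (x ∷ xs) with P? x
  ... | yes _ = prep x (filter++filter-∁-↭ xs)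
  ... | no  _ = ↭-trans (prep x (filter++filter-∁-↭ xs)) (↭-sym (Perm.shift x _ _))

  length-filter+length-filter-∁ : ∀ xs →
    length (filter P? xs) ℕ.+ length (filter (∁? P?) xs) ≡ length xs
  length-filter+length-filter-∁ xs =
    sym (trans (Perm.↭-length (filter++filter-∁-↭ xs)) (List.length-++ (filter P? xs)))

  length-filter-map : ∀ {b} {B : Set b} (f : B → A) xs →
    length (filter P? (map f xs)) ≡ length (filter (λ x → P? (f x)) xs)
  length-filter-map f []       = refl
  length-filter-map f (x ∷ xs) with P? (f x)
  ... | yes _ = cong suc (length-filter-map f xs)
  ... | no  _ = length-filter-map f xs

countAtMost : ℕ → List ℕ → ℕ
countAtMost J bs = length (filter (_≤? J) bs)

countAbove : ℕ → List ℕ → ℕ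
countAbove J bs = length (filter (∁? (_≤? J)) bs)

countAtMost-zero : ∀ {bs} → All (1 ≤_) bs → countAtMost 0 bs ≡ 0
countAtMost-zero bs≥1 = cong length (List.filter-none (_≤? 0) (All.map ℕP.<⇒≱ bs≥1))

countAtMost-accept : ∀ {J b} bs → b ≤ J → countAtMost J (b ∷ bs) ≡ suc (countAtMost J bs)
countAtMost-accept {J} bs b≤J = cong length (List.filter-accept (_≤? J) {xs = bs} b≤J)

countAbove-antitone : ∀ as bs → length as ≡ length bs →
  ∀ J → countAtMost J bs ≤ countAtMost J as → countAbove J as ≤ countAbove J bs
countAbove-antitone as bs |as|≡|bs| J bs≤as = ℕP.+-cancelˡ-≤ (countAtMost J bs) _ _ (begin
  countAtMost J bs ℕ.+ countAbove J as  ≤⟨ ℕP.+-monoˡ-≤ (countAbove J as) bs≤as ⟩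
  countAtMost J as ℕ.+ countAbove J as  ≡⟨ length-filter+length-filter-∁ (_≤? J) as ⟩
  length as                             ≡⟨ |as|≡|bs| ⟩
  length bs                             ≡⟨ length-filter+length-filter-∁ (_≤? J) bs ⟨
  countAtMost J bs ℕ.+ countAbove J bs  ∎)
  where open ℕP.≤-Reasoning

sum-map-⊓-zero : ∀ bs → sum (map (_⊓ 0) bs) ≡ 0
sum-map-⊓-zero []       = refl
sum-map-⊓-zero (b ∷ bs) = cong₂ ℕ._+_ (ℕP.⊓-zeroʳ b) (sum-map-⊓-zero bs)

sum-map-⊓-suc : ∀ M bs → sum (map (_⊓ suc M) bs) ≡ sum (map (_⊓ M) bs) ℕ.+ countAbove M bs
sum-map-⊓-suc M []       = refl
sum-map-⊓-suc M (b ∷ bs) with b ≤? M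
... | yes b≤M rewrite List.filter-reject (∁? (_≤? M)) {b} {bs} (λ b≰M → b≰M b≤M) = begin
  b ⊓ suc M ℕ.+ sum (map (_⊓ suc M) bs)  ≡⟨ cong₂ ℕ._+_ b⊓1+M≡b (sum-map-⊓-suc M bs) ⟩
  b ℕ.+ (S ℕ.+ A)                        ≡⟨ ℕP.+-assoc b S A ⟨
  b ℕ.+ S ℕ.+ A                          ≡⟨ cong (λ c → c ℕ.+ S ℕ.+ A) (ℕP.m≤n⇒m⊓n≡m b≤M) ⟨
  b ⊓ M ℕ.+ S ℕ.+ A                      ∎
  where
  open ≡-Reasoning
  S A : ℕ
  S = sum (map (_⊓ M) bs)
  A = countAbove M bs
  b⊓1+M≡b : b ⊓ suc M ≡ b
  b⊓1+M≡b = ℕP.m≤n⇒m⊓n≡m (ℕP.m≤n⇒m≤1+n b≤M)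
... | no b≰M rewrite List.filter-accept (∁? (_≤? M)) {b} {bs} b≰M = begin
  b ⊓ suc M ℕ.+ sum (map (_⊓ suc M) bs)  ≡⟨ cong₂ ℕ._+_ (ℕP.m≥n⇒m⊓n≡n M<b) (sum-map-⊓-suc M bs) ⟩
  suc (M ℕ.+ (S ℕ.+ A))                  ≡⟨ cong suc (ℕP.+-assoc M S A) ⟨
  suc (M ℕ.+ S ℕ.+ A)                    ≡⟨ ℕP.+-suc (M ℕ.+ S) A ⟨
  M ℕ.+ S ℕ.+ suc A                      ≡⟨ cong (λ c → c ℕ.+ S ℕ.+ suc A) (ℕP.m≥n⇒m⊓n≡n (ℕP.<⇒≤ M<b)) ⟨
  b ⊓ M ℕ.+ S ℕ.+ suc A                  ∎
  where
  open ≡-Reasoning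
  S A : ℕ
  S = sum (map (_⊓ M) bs)
  A = countAbove M bs
  M<b : M < b
  M<b = ℕP.≰⇒> b≰M

map-⊓-of-sum≤ : ∀ {M} bs → sum bs ≤ M → map (_⊓ M) bs ≡ bs
map-⊓-of-sum≤ []       _         = refl
map-⊓-of-sum≤ (b ∷ bs) b+Σbs≤M = cong₂ _∷_
  (ℕP.m≤n⇒m⊓n≡m (ℕP.≤-trans (ℕP.m≤m+n b (sum bs)) b+Σbs≤M))
  (map-⊓-of-sum≤ bs (ℕP.≤-trans (ℕP.m≤n+m (sum bs) b) b+Σbs≤M))

-- Layer cake: Σ (b ⊓ K) is the sum over j < K of the number of entries above j.
sum-mono-countAtMost : ∀ as bs → length as ≡ length bs →
  (∀ J → countAtMost J bs ≤ countAtMost J as) → sum as ≤ sum bs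
sum-mono-countAtMost as bs |as|≡|bs| dominated = begin
  sum as               ≡⟨ cong sum (map-⊓-of-sum≤ as (ℕP.m≤m+n (sum as) (sum bs))) ⟨
  sum (map (_⊓ M) as)  ≤⟨ capped M ⟩
  sum (map (_⊓ M) bs)  ≡⟨ cong sum (map-⊓-of-sum≤ bs (ℕP.m≤n+m (sum bs) (sum as))) ⟩
  sum bs               ∎
  where
  open ℕP.≤-Reasoning
  M : ℕ
  M = sum as ℕ.+ sum bs
  above≤ : ∀ K → countAbove K as ≤ countAbove K bs
  above≤ K = countAbove-antitone as bs |as|≡|bs| K (dominated K)
  capped : ∀ K → sum (map (_⊓ K) as) ≤ sum (map (_⊓ K) bs)
  capped zero    = ℕP.≤-reflexive (trans (sum-map-⊓-zero as) (sym (sum-map-⊓-zero bs)))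
  capped (suc K) = begin
    sum (map (_⊓ suc K) as)                  ≡⟨ sum-map-⊓-suc K as ⟩
    sum (map (_⊓ K) as) ℕ.+ countAbove K as  ≤⟨ ℕP.+-mono-≤ (capped K) (above≤ K) ⟩
    sum (map (_⊓ K) bs) ℕ.+ countAbove K bs  ≡⟨ sum-map-⊓-suc K bs ⟨
    sum (map (_⊓ suc K) bs)                  ∎

module _ {X : Set} (f : X → ℕ) (g : X → ℚ) where

  loadOf : ℕ → List X → ℚ
  loadOf j = foldr (λ x acc → if f x ≡ᵇ j then g x + acc else acc) 0ℚ

  weightsAtMost : ℕ → List X → List ℚ
  weightsAtMost J xs = map g (filter (λ x → f x ≤? J) xs)

  sumℚ-weightsAtMost-suc : ∀ J xs →
    sumℚ (weightsAtMost (suc J) xs) ≡ sumℚ (weightsAtMost J xs) + loadOf (suc J) xs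
  sumℚ-weightsAtMost-suc J [] = sym (ℚP.+-identityʳ 0ℚ)
  sumℚ-weightsAtMost-suc J (x ∷ xs) with ℕP.<-cmp (f x) (suc J)
  ... | tri< fx≤J fx≢1+J _
    rewrite List.filter-accept (λ x → f x ≤? suc J) {x} {xs} (ℕP.<⇒≤ fx≤J)
          | List.filter-accept (λ x → f x ≤? J) {x} {xs} (ℕP.≤-pred fx≤J)
          | dec-false (f x ℕ.≟ suc J) fx≢1+J
    = trans (cong (g x +_) (sumℚ-weightsAtMost-suc J xs)) (sym (ℚP.+-assoc (g x) _ _))
  ... | tri≈ _ fx≡1+J _
    rewrite List.filter-accept (λ x → f x ≤? suc J) {x} {xs} (ℕP.≤-reflexive fx≡1+J)
          | List.filter-reject (λ x → f x ≤? J) {x} {xs} (λ fx≤J → ℕP.<-irrefl fx≡1+J (s≤s fx≤J))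
          | dec-true (f x ℕ.≟ suc J) fx≡1+J
    = trans (cong (g x +_) (sumℚ-weightsAtMost-suc J xs))
            (x∙yz≈y∙xz (g x) (sumℚ (weightsAtMost J xs)) (loadOf (suc J) xs))
  ... | tri> _ fx≢1+J 1+J<fx
    rewrite List.filter-reject (λ x → f x ≤? suc J) {x} {xs} (ℕP.<⇒≱ 1+J<fx)
          | List.filter-reject (λ x → f x ≤? J) {x} {xs} (ℕP.<⇒≱ (ℕP.<-trans (ℕP.n<1+n J) 1+J<fx))
          | dec-false (f x ℕ.≟ suc J) fx≢1+J
    = sumℚ-weightsAtMost-suc J xs

  sumℚ-weightsAtMost≤ : ∀ {xs} → All (λ x → 1 ≤ f x) xs → (∀ j → loadOf j xs ℚ.≤ 1ℚ) →
    ∀ J → sumℚ (weightsAtMost J xs) ℚ.≤ toℚ J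
  sumℚ-weightsAtMost≤ f≥1 _ zero
    rewrite List.filter-none (λ x → f x ≤? 0) (All.map ℕP.<⇒≱ f≥1)
    = ℚP.≤-refl
  sumℚ-weightsAtMost≤ {xs} f≥1 loads≤1 (suc J) = begin
    sumℚ (weightsAtMost (suc J) xs)               ≡⟨ sumℚ-weightsAtMost-suc J xs ⟩
    sumℚ (weightsAtMost J xs) + loadOf (suc J) xs ≤⟨ ℚP.+-mono-≤ (sumℚ-weightsAtMost≤ f≥1 loads≤1 J)
                                                                    (loads≤1 (suc J)) ⟩
    toℚ J + 1ℚ                                     ∎
    where open ℚP.≤-Reasoning

  sumℚ-take-countAtMost≤ : ∀ {xs ws} → Sorted ws → ws ↭ map g xs →
    All (λ x → 1 ≤ f x) xs → (∀ j → loadOf j xs ℚ.≤ 1ℚ) →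
    ∀ J → sumℚ (take (countAtMost J (map f xs)) ws) ℚ.≤ toℚ J
  sumℚ-take-countAtMost≤ {xs} {ws} ws↗ ws↭ f≥1 loads≤1 J = begin
    sumℚ (take (countAtMost J (map f xs)) ws)     ≡⟨ cong (λ m → sumℚ (take m ws)) |packed| ⟩
    sumℚ (take (length (weightsAtMost J xs)) ws)  ≤⟨ sumℚ-take-sorted-++≤ (weightsAtMost J xs) (map g rest) ws↗ ws↭packed++rest ⟩
    sumℚ (weightsAtMost J xs)                     ≤⟨ sumℚ-weightsAtMost≤ f≥1 loads≤1 J ⟩
    toℚ J                                         ∎
    where
    open ℚP.≤-Reasoning
    packed rest : List X
    packed = filter (λ x → f x ≤? J) xs
    rest   = filter (∁? (λ x → f x ≤? J)) xs
    |packed| : countAtMost J (map f xs) ≡ length (weightsAtMost J xs)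
    |packed| = trans (length-filter-map (_≤? J) f xs) (sym (List.length-map g packed))
    ws↭packed++rest : ws ↭ weightsAtMost J xs ++ map g rest
    ws↭packed++rest = ↭-trans ws↭ (subst (map g xs ↭_) (List.map-++ g packed rest)
      (Perm.map⁺ g (filter++filter-∁-↭ (λ x → f x ≤? J) xs)))

nfiBins-length : ∀ j s ws → length (nfiBins j s ws) ≡ length ws
nfiBins-length j s []       = refl
nfiBins-length j s (w ∷ ws) with 1ℚ ℚP.<? (s + w)
... | yes _ = cong suc (nfiBins-length (suc j) 0ℚ ws)
... | no  _ = cong suc (nfiBins-length j (s + w) ws)

-- Started in bin i + 1 with load s, NFI⁺ leaves bin j only once its load exceeds 1; so if some item
-- lands beyond bin J, each of the bins i + 1, …, J holds more than 1 and J < i + s + (weight placed in them).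
nfiBins-overfull : ∀ {J} i s ws → All (0ℚ ℚ.≤_) ws → suc i ≤ J →
  countAtMost J (nfiBins (suc i) s ws) < length ws →
  toℚ J ℚ.< toℚ i + (s + sumℚ (take (countAtMost J (nfiBins (suc i) s ws)) ws))
nfiBins-overfull i s [] _ _ ()
nfiBins-overfull {J} i s (w ∷ ws) (w≥0 ∷ ws≥0) 1+i≤J c<|ws| with 1ℚ ℚP.<? (s + w)
... | yes overfull rewrite countAtMost-accept (nfiBins (suc (suc i)) 0ℚ ws) 1+i≤J = begin-strict
  toℚ J                   ≤⟨ J≤ (suc (suc i) ≤? J) ⟩
  toℚ i + 1ℚ + S          ≡⟨ ℚP.+-assoc (toℚ i) 1ℚ S ⟩
  toℚ i + (1ℚ + S)        <⟨ ℚP.+-monoʳ-< (toℚ i) (ℚP.+-monoˡ-< S overfull) ⟩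
  toℚ i + (s + w + S)     ≡⟨ cong (toℚ i +_) (ℚP.+-assoc s w S) ⟩
  toℚ i + (s + (w + S))   ∎
  where
  open ℚP.≤-Reasoning
  c : ℕ
  c = countAtMost J (nfiBins (suc (suc i)) 0ℚ ws)
  S : ℚ
  S = sumℚ (take c ws)
  J≤ : Dec (suc (suc i) ≤ J) → toℚ J ℚ.≤ toℚ i + 1ℚ + S
  J≤ (yes 2+i≤J) = ℚP.<⇒≤ (subst (toℚ J ℚ.<_) (cong (toℚ i + 1ℚ +_) (ℚP.+-identityˡ S))
    (nfiBins-overfull (suc i) 0ℚ ws ws≥0 2+i≤J (ℕP.≤-pred c<|ws|)))
  J≤ (no 2+i≰J) = begin
    toℚ J            ≡⟨ cong toℚ (ℕP.≤-antisym (ℕP.≮⇒≥ 2+i≰J) 1+i≤J) ⟩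
    toℚ i + 1ℚ       ≡⟨ ℚP.+-identityʳ (toℚ i + 1ℚ) ⟨
    toℚ i + 1ℚ + 0ℚ  ≤⟨ ℚP.+-monoʳ-≤ (toℚ i + 1ℚ) (sumℚ-nonneg (All.take⁺ c ws≥0)) ⟩
    toℚ i + 1ℚ + S   ∎
... | no _ rewrite countAtMost-accept (nfiBins (suc i) (s + w) ws) 1+i≤J = begin-strict
  toℚ J                   <⟨ nfiBins-overfull i (s + w) ws ws≥0 1+i≤J (ℕP.≤-pred c<|ws|) ⟩
  toℚ i + (s + w + S)     ≡⟨ cong (toℚ i +_) (ℚP.+-assoc s w S) ⟩
  toℚ i + (s + (w + S))   ∎
  where
  open ℚP.≤-Reasoning
  S : ℚ
  S = sumℚ (take (countAtMost J (nfiBins (suc i) (s + w) ws)) ws)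

sortedWeights-length : ∀ {I ws} → SortedWeights I ws → (P : Packing I) →
  length ws ≡ length (map (bin P) (allFin (n I)))
sortedWeights-length {I} (ws↭ , _) P = begin
  _                                   ≡⟨ Perm.↭-length ws↭ ⟩
  length (map (weight I) (allFin (n I))) ≡⟨ List.length-map (weight I) (allFin (n I)) ⟩
  length (allFin (n I))               ≡⟨ List.length-map (bin P) (allFin (n I)) ⟨
  length (map (bin P) (allFin (n I))) ∎
  where open ≡-Reasoning

bins≥1 : ∀ {I} (P : Packing I) → All (λ x → 1 ≤ bin P x) (allFin (n I))
bins≥1 P = All.tabulate λ {x} _ → bin≥1 P x

nfi-countAtMost-dominates : (I : Instance) (ws : List ℚ) → SortedWeights I ws →
  (P : Packing I) → Feasible P →
  ∀ J → countAtMost J (map (bin P) (allFin (n I))) ≤ countAtMost J (nfiBins 1 0ℚ ws)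
nfi-countAtMost-dominates I ws _ P _ zero =
  ℕP.≤-trans (ℕP.≤-reflexive (countAtMost-zero (All.map⁺ (bins≥1 P)))) z≤n
nfi-countAtMost-dominates I ws sorted@(ws↭ , ws↗) P feasible (suc J) = ℕP.≮⇒≥ λ c<m →
  ℚP.<-irrefl refl (begin-strict
    toℚ (suc J)                    <⟨ nfiBins-overfull 0 0ℚ ws ws≥0 (s≤s z≤n) (c<|ws| c<m) ⟩
    0ℚ + (0ℚ + sumℚ (take c ws))   ≡⟨ trans (ℚP.+-identityˡ _) (ℚP.+-identityˡ _) ⟩
    sumℚ (take c ws)               ≤⟨ sumℚ-take-mono ws≥0 (ℕP.<⇒≤ c<m) ⟩
    sumℚ (take m ws)               ≤⟨ sumℚ-take-countAtMost≤ (bin P) (weight I) ws↗ ws↭ (bins≥1 P)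
                                                             feasible (suc J) ⟩
    toℚ (suc J)                    ∎)
  where
  open ℚP.≤-Reasoning
  m c : ℕ
  m = countAtMost (suc J) (map (bin P) (allFin (n I)))
  c = countAtMost (suc J) (nfiBins 1 0ℚ ws)
  c<|ws| : c < m → c < length ws
  c<|ws| c<m = ℕP.<-≤-trans c<m (ℕP.≤-trans (List.length-filter (_≤? suc J) (map (bin P) (allFin (n I))))
    (ℕP.≤-reflexive (sym (sortedWeights-length sorted P))))
  ws≥0 : All (0ℚ ℚ.≤_) ws
  ws≥0 = Perm.All-resp-↭ (↭-sym ws↭) (All.map⁺ weights≥0)
    where
    weights≥0 : All (λ x → 0ℚ ℚ.≤ weight I x) (allFin (n I))
    weights≥0 = All.tabulate λ {x} _ → ℚP.<⇒≤ (w>0 I x)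

mainTheorem6 : (I : Instance) (ws : List ℚ) → SortedWeights I ws →
    (P : Packing I) → Feasible P → RespectsReadyTimes P →
    nfiCost ws ≤ cost P
mainTheorem6 I ws sorted P feasible _ =
  sum-mono-countAtMost (nfiBins 1 0ℚ ws) (map (bin P) (allFin (n I)))
    (trans (nfiBins-length 1 0ℚ ws) (sortedWeights-length sorted P))
    (nfi-countAtMost-dominates I ws sorted P feasible)
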